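{- Let $X$ be a $d$-dimensional simplicial complex, $f\in C^k(X)$ with $k<d$, and $0\le\ell\le k-1$. If $f$ is $1$-double balanced in dimension $\ell$, then $f$ is $1$-double balanced in every dimension $\ell'$ with $0\le\ell'\le\ell$.
   Context: $X$ is a finite downward-closed family of finite sets (faces) with maximal faces of size $d+1$; $X(j)$ is the set of $j$-faces (size $j+1$), $X(-1)=\{\emptyset\}$. Standing assumption: $P_d$ on $X(d)$ is uniform; for $j<d$, $P_j$ is obtained by drawing $\sigma\sim P_d$ and then a uniformly random $j$-subface. The link $X_\sigma=\{\tau\setminus\sigma:\sigma\subseteq\tau\in X\}$ carries the induced conditional distributions. $C^j(X)$ is the space of functions $X(j)\to\mathbb{F}_2$, $\|f\|=\Pr_{\sigma\sim P_j}[f(\sigma)\ne0]$ (on links, with link distributions). For $f\in C^k(X)$ and $\sigma\in X(\ell)$, $\ell<k$: localization $f_\sigma\in C^{k-\ell-1}(X_\sigma)$, $f_\sigma(\tau)=f(\sigma\cup\tau)$; restriction $f^\sigma\in C^k(X_\sigma)$, $f^\sigma(\tau)=f(\tau)$; $f_\emptyset=f$. $f$ is $\alpha$-double balanced in dimension $\ell$ ($\alpha\ge1$) if for every $\sigma\in X(\ell)$, $\|f_\sigma\|\le\alpha\,\mathbb{E}_{u\in\sigma}\|(f_{\sigma\setminus u})^u\|$, where $u$ is uniform among the vertices of $\sigma$ and $(f_{\sigma\setminus u})^u\in C^{k-\ell}(X_\sigma)$ is the restriction of $f_{\sigma\setminus u}$ to the link of $u$ in $X_{\sigma\setminus u}$,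 namely $X_\sigma$. -}

module Defs where

open import Data.Bool using (Bool; true; false; if_then_else_; _∧_; _∨_; not)
open import Data.Nat using (ℕ; zero; suc; _+_; _∸_; _<_; _≡ᵇ_; _<ᵇ_)
open import Data.List using (List; []; _∷_; length; map; foldr)
open import Data.List.Relation.Unary.Unique.Propositional using (Unique)
open import Data.List.Relation.Unary.All using (All)
open import Data.List.Relation.Unary.Any using (Any)
open import Data.List.Relation.Unary.Linked using (Linked)
open import Data.Product using (_×_)
open import Data.Integer using (+_)
open import Data.Rational using (ℚ; 0ℚ; 1ℚ; _/_; _*_; _≤_) renaming (_+_ to _+ℚ_)
open import Relation.Binary.PropositionalEquality using (_≡_)
open import Relation.Nullary.Decidable using (does)
open import Data.Nat using (_≟_)

-- Finite sets of vertices are represented canonically as strictly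
-- increasing lists of natural numbers.

-- The complex X is the downward closure of the facets.
record Complex : Set where
  field
    dim        : ℕ
    facets     : List (List ℕ)
    sorted     : All (Linked _<_) facets
    facetSize  : All (λ F → length F ≡ suc dim) facets
    distinct   : Unique facets
    nonempty   : 0 < length facets
open Complex public

filterB : {A : Set} → (A → Bool) → List A → List A
filterB p [] = []
filterB p (x ∷ xs) = if p x then x ∷ filterB p xs else filterB p xs

anyB : {A : Set} → (A → Bool) → List A → Bool
anyB p [] = false
anyB p (x ∷ xs) = p x ∨ anyB p xs

allB : {A : Set} → (A → Bool) → List A → Bool
allB p [] = true
allB p (x ∷ xs) = p x ∧ allB p xs

_∈ᵇ_ : ℕ → List ℕ → Bool
v ∈ᵇ xs = anyB (λ y → v ≡ᵇ y) xs

_⊆ᵇ_ : List ℕ → List ℕ → Bool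
σ ⊆ᵇ F = allB (λ v → v ∈ᵇ F) σ

_minus_ : List ℕ → List ℕ → List ℕ
F minus σ = filterB (λ v → not (v ∈ᵇ σ)) F

remove : ℕ → List ℕ → List ℕ
remove u σ = filterB (λ v → not (v ≡ᵇ u)) σ

-- sorted insertion and union (for disjoint sorted lists gives the sorted union)
insert : ℕ → List ℕ → List ℕ
insert x [] = x ∷ []
insert x (y ∷ ys) = if x <ᵇ y then x ∷ y ∷ ys else y ∷ insert x ys

_∪_ : List ℕ → List ℕ → List ℕ
σ ∪ τ = foldr insert τ σ

combinations : ℕ → List ℕ → List (List ℕ)
combinations zero    xs       = [] ∷ []
combinations (suc r) []       = []
combinations (suc r) (x ∷ xs) = map (x ∷_) (combinations r xs) Data.List.++ combinations (suc r) xs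

-- j-faces: σ ∈ X(j) iff σ has j+1 elements and lies in some facet
-- (σ is then automatically strictly increasing, being a sublist of a facet;
-- we require σ strictly increasing for canonicity).
Face : Complex → ℕ → List ℕ → Set
Face X j σ = Linked _<_ σ × length σ ≡ suc j × Any (λ F → (σ ⊆ᵇ F) ≡ true) (facets X)

-- F₂-valued cochains; a k-cochain is only ever evaluated on k-faces.
Cochain : Set
Cochain = List ℕ → Bool

-- a / b as a rational (b = 0 never occurs in the uses below; set to 0)
frac : ℕ → ℕ → ℚ
frac a zero    = 0ℚ
frac a (suc b) = (+ a) / suc b

sumℚ : List ℚ → ℚ
sumℚ = foldr _+ℚ_ 0ℚ

avg : List ℚ → ℚ
avg xs = sumℚ xs * frac 1 (length xs)

count : (List ℕ → Bool) → List (List ℕ) → ℕ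
count g xs = length (filterB g xs)

-- The top distribution of X_σ is uniform on the
-- facets of X containing σ (P_d conditioned); an (r-1)-face of X_σ is
-- drawn by taking such a facet F and a uniform r-subset of F ∖ σ.
-- linkNorm X σ r g = Pr_{τ ∼ P_{r-1}(X_σ)} [ g τ ≠ 0 ].
containing : Complex → List ℕ → List (List ℕ)
containing X σ = filterB (λ F → σ ⊆ᵇ F) (facets X)

linkNorm : Complex → List ℕ → ℕ → (List ℕ → Bool) → ℚ
linkNorm X σ r g =
  avg (map (λ F → frac (count g (combinations r (F minus σ)))
                       (length (combinations r (F minus σ))))
           (containing X σ))

-- ‖ f_σ ‖ for f ∈ C^k(X), σ ∈ X(ℓ):  f_σ ∈ C^{k-ℓ-1}(X_σ), f_σ(τ) = f(σ ∪ τ)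
normLoc : Complex → ℕ → Cochain → ℕ → List ℕ → ℚ
normLoc X k f ℓ σ = linkNorm X σ (k ∸ ℓ) (λ τ → f (σ ∪ τ))

-- ‖ (f_{σ∖u})^u ‖ ∈ C^{k-ℓ}(X_σ), τ ↦ f((σ∖u) ∪ τ)
normRes : Complex → ℕ → Cochain → ℕ → List ℕ → ℕ → ℚ
normRes X k f ℓ σ u = linkNorm X σ (suc (k ∸ ℓ)) (λ τ → f (remove u σ ∪ τ))

DoubleBalanced : Complex → ℕ → Cochain → ℚ → ℕ → Set
DoubleBalanced X k f α ℓ =
  (σ : List ℕ) → Face X ℓ σ →
  normLoc X k f ℓ σ ≤ α * avg (map (normRes X k f ℓ σ) σ)

{-# OPTIONS --safe #-}
-- It suffices to go down one dimension. Let ρ be an m-face and let v range over the vertices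
-- outside ρ. With denominators cleared, the hypothesis at ρ ∪ {v} reads
--   (m+2) Σ_{F ⊇ ρ∪v} loc_v(F) ≤ Σ_{u ∈ ρ∪v} Σ_{F ⊇ ρ∪v} res_{v,u}(F).
-- Sum over v and exchange with the sum over the facets F ⊇ ρ. Double counting the subsets of
-- F ∖ ρ, whose size d − m does not depend on F, turns the left side into (m+2)(d−m) ΣA and the
-- right side into (d−m) ΣA + (d−m) ΣB, where ΣA and ΣB are the cleared forms of ‖f_ρ‖ and of
-- Σ_{w∈ρ} ‖(f_{ρ∖w})^w‖; the term (d−m) ΣA on the right comes from restricting at u = v.
-- Hence (m+1) ΣA ≤ ΣB, which is the inequality at ρ.
module Submission where

open import Defs
open import Data.Bool using (Bool; true; false; if_then_else_; _∧_; _∨_; not; T)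
open import Data.Bool.Properties
  using (not-injective; ∧-zeroʳ; ∧-identityʳ; ∨-zeroʳ; ∨-conicalˡ; ∨-conicalʳ; ∧-conicalˡ; ∧-conicalʳ)
open import Data.Nat as ℕ using (ℕ; zero; suc; z≤n; s≤s; _+_; _*_; _∸_; _<_; _≤_; _≡ᵇ_; _<ᵇ_)
open import Data.Nat.Properties as ℕ using (<ᵇ-reflects-<; ≡ᵇ⇒≡; ≡⇒≡ᵇ; <-cmp; <-irrefl; <-trans; <-asym)
open import Data.Nat.Tactic.RingSolver using (solve-∀)
open import Data.Nat.Coprimality using (1-coprimeTo) renaming (sym to coprime-sym)
open import Data.List using (List; []; _∷_; length; map; _++_)
import Data.List.Properties as List
import Data.List.Relation.Unary.All.Properties as All
open import Data.List.Relation.Unary.All as All using (All; []; _∷_)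
open import Data.List.Relation.Unary.AllPairs using (AllPairs; []; _∷_)
open import Data.List.Relation.Unary.Linked using (Linked)
open import Data.List.Relation.Unary.Linked.Properties using (Linked⇒AllPairs; AllPairs⇒Linked)
open import Data.List.Relation.Unary.Any using (Any; here; there)
open import Data.Product using (_×_; _,_)
open import Data.Sum using (inj₁; inj₂)
open import Relation.Binary.Definitions using (tri<; tri≈; tri>)
open import Relation.Binary.PropositionalEquality
  using (_≡_; _≢_; refl; sym; trans; cong; cong₂; subst; subst₂; module ≡-Reasoning)
open import Function using (_∘_; id)
open import Algebra.Properties.CommutativeSemigroup ℕ.+-commutativeSemigroup
  using () renaming (interchange to +-interchange)
import Data.Integer as ℤ
import Data.Integer.Properties as ℤ
open import Data.Rational as ℚ using (ℚ; mkℚ; 0ℚ; 1ℚ; toℚᵘ)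
import Data.Rational.Properties as ℚ
open import Data.Rational.Unnormalised as ℚᵘ using (mkℚᵘ; *≡*; _≃_)
import Data.Rational.Unnormalised.Properties as ℚᵘ
open import Data.Rational.Solver using (module +-*-Solver)
open +-*-Solver using (solve; _:+_; _:*_; :-_; _:=_; con)
open import Algebra.Bundles using (CommutativeMonoid)
open import Algebra.Properties.CommutativeSemigroup
  (CommutativeMonoid.commutativeSemigroup ℚ.+-0-commutativeMonoid)
  using () renaming (interchange to +ℚ-interchange; x∙yz≈y∙xz to +ℚ-swap)
open import Relation.Nullary using (¬_; contradiction)
open import Relation.Nullary.Reflects using (Reflects; ofʸ; ofⁿ; fromEquivalence)

≡ᵇ-refl : ∀ n → (n ≡ᵇ n) ≡ true
≡ᵇ-refl zero    = refl
≡ᵇ-refl (suc n) = ≡ᵇ-refl n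

≡ᵇ-sym : ∀ m n → (m ≡ᵇ n) ≡ (n ≡ᵇ m)
≡ᵇ-sym zero    zero    = refl
≡ᵇ-sym zero    (suc n) = refl
≡ᵇ-sym (suc m) zero    = refl
≡ᵇ-sym (suc m) (suc n) = ≡ᵇ-sym m n

≡ᵇ-reflects-≡ : ∀ m n → Reflects (m ≡ n) (m ≡ᵇ n)
≡ᵇ-reflects-≡ m n = fromEquivalence (≡ᵇ⇒≡ m n) (≡⇒≡ᵇ m n)

≢⇒≡ᵇ≡false : ∀ {m n} → m ≢ n → (m ≡ᵇ n) ≡ false
≢⇒≡ᵇ≡false {m} {n} m≢n with m ≡ᵇ n | ≡ᵇ-reflects-≡ m n
... | true  | ofʸ m≡n = contradiction m≡n m≢n
... | false | _       = refl

<⇒<ᵇ≡true : ∀ {m n} → m < n → (m <ᵇ n) ≡ true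
<⇒<ᵇ≡true {m} {n} m<n with m <ᵇ n | <ᵇ-reflects-< m n
... | true  | _        = refl
... | false | ofⁿ m≮n = contradiction m<n m≮n

≮⇒<ᵇ≡false : ∀ {m n} → ¬ m < n → (m <ᵇ n) ≡ false
≮⇒<ᵇ≡false {m} {n} m≮n with m <ᵇ n | <ᵇ-reflects-< m n
... | true  | ofʸ m<n = contradiction m<n m≮n
... | false | _        = refl

<ᵇ≡true⇒< : ∀ {m n} → (m <ᵇ n) ≡ true → m < n
<ᵇ≡true⇒< {m} {n} m<ᵇn = ℕ.<ᵇ⇒< m n (subst T (sym m<ᵇn) _)

<⇒≢ᵇ : ∀ {m n} → m < n → (m ≡ᵇ n) ≡ false
<⇒≢ᵇ m<n = ≢⇒≡ᵇ≡false (ℕ.<⇒≢ m<n)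

>⇒≢ᵇ : ∀ {m n} → n < m → (m ≡ᵇ n) ≡ false
>⇒≢ᵇ n<m = ≢⇒≡ᵇ≡false (ℕ.>⇒≢ n<m)

∨-swap : ∀ a b c → a ∨ (b ∨ c) ≡ b ∨ (a ∨ c)
∨-swap false b c = refl
∨-swap true false c = refl
∨-swap true true c = refl

∧-swap : ∀ a b c → a ∧ (b ∧ c) ≡ b ∧ (a ∧ c)
∧-swap false false c = refl
∧-swap false true c = refl
∧-swap true b c = refl

not-∨ : ∀ a b → not (a ∨ b) ≡ not b ∧ not a
not-∨ false false = refl
not-∨ false true = refl
not-∨ true false = refl
not-∨ true true = refl

insert-comm-< : ∀ {x y} → x < y → ∀ L → insert x (insert y L) ≡ insert y (insert x L)
insert-comm-< {x} {y} x<y [] rewrite <⇒<ᵇ≡true x<y | ≮⇒<ᵇ≡false (<-asym x<y) = refl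
insert-comm-< {x} {y} x<y (z ∷ zs) with y <ᵇ z in y<ᵇz | x <ᵇ z in x<ᵇz
... | true  | false with () ← trans (sym (<⇒<ᵇ≡true (<-trans x<y (<ᵇ≡true⇒< {y} {z} y<ᵇz)))) x<ᵇz
... | true  | true  rewrite <⇒<ᵇ≡true x<y | ≮⇒<ᵇ≡false (<-asym x<y) | y<ᵇz = refl
... | false | true  rewrite ≮⇒<ᵇ≡false (<-asym x<y) | y<ᵇz | x<ᵇz = refl
... | false | false rewrite y<ᵇz | x<ᵇz = cong (z ∷_) (insert-comm-< x<y zs)

insert-comm : ∀ x y L → insert x (insert y L) ≡ insert y (insert x L)
insert-comm x y L with <-cmp x y
... | tri< x<y _ _ = insert-comm-< x<y L
... | tri≈ _ refl _ = refl
... | tri> _ _ y<x = sym (insert-comm-< y<x L)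

length-insert : ∀ v L → length (insert v L) ≡ suc (length L)
length-insert v []       = refl
length-insert v (y ∷ ys) with v <ᵇ y
... | true  = refl
... | false = cong suc (length-insert v ys)

∈ᵇ-insert : ∀ w v L → (w ∈ᵇ insert v L) ≡ ((w ≡ᵇ v) ∨ (w ∈ᵇ L))
∈ᵇ-insert w v [] = refl
∈ᵇ-insert w v (y ∷ ys) with v <ᵇ y
... | true  = refl
... | false = trans (cong ((w ≡ᵇ y) ∨_) (∈ᵇ-insert w v ys)) (∨-swap (w ≡ᵇ y) (w ≡ᵇ v) (w ∈ᵇ ys))

allB-insert : ∀ (p : ℕ → Bool) v L → allB p (insert v L) ≡ (p v ∧ allB p L)
allB-insert p v [] = refl
allB-insert p v (y ∷ ys) with v <ᵇ y
... | true  = refl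
... | false = trans (cong (p y ∧_) (allB-insert p v ys)) (∧-swap (p y) (p v) (allB p ys))

filterB-insert-reject : ∀ (p : ℕ → Bool) v L → p v ≡ false → filterB p (insert v L) ≡ filterB p L
filterB-insert-reject p v [] pv rewrite pv = refl
filterB-insert-reject p v (y ∷ ys) pv with v <ᵇ y
... | true rewrite pv = refl
... | false with p y
...   | true  = cong (y ∷_) (filterB-insert-reject p v ys pv)
...   | false = filterB-insert-reject p v ys pv

filterB-accept : ∀ {A : Set} (p : A → Bool) L → All (λ x → p x ≡ true) L → filterB p L ≡ L
filterB-accept p [] [] = refl
filterB-accept p (x ∷ xs) (px ∷ pxs) rewrite px = cong (x ∷_) (filterB-accept p xs pxs)

filterB-filterB : ∀ {A : Set} (p q : A → Bool) L → filterB p (filterB q L) ≡ filterB (λ x → q x ∧ p x) L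
filterB-filterB p q [] = refl
filterB-filterB p q (x ∷ xs) with q x
... | false = filterB-filterB p q xs
... | true with p x
...   | true  = cong (x ∷_) (filterB-filterB p q xs)
...   | false = filterB-filterB p q xs

filterB-cong : ∀ {A : Set} {p q : A → Bool} L → (∀ x → p x ≡ q x) → filterB p L ≡ filterB q L
filterB-cong [] p≗q = refl
filterB-cong {q = q} (x ∷ xs) p≗q rewrite p≗q x with q x
... | true  = cong (x ∷_) (filterB-cong xs p≗q)
... | false = filterB-cong xs p≗q

∪-insertʳ : ∀ v ρ τ → ρ ∪ insert v τ ≡ insert v (ρ ∪ τ)
∪-insertʳ v [] τ = refl
∪-insertʳ v (y ∷ ys) τ = trans (cong (insert y) (∪-insertʳ v ys τ)) (insert-comm y v (ys ∪ τ))

∪-insertˡ : ∀ v ρ τ → insert v ρ ∪ τ ≡ insert v (ρ ∪ τ)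
∪-insertˡ v [] τ = refl
∪-insertˡ v (y ∷ ys) τ with v <ᵇ y
... | true  = refl
... | false = trans (cong (insert y) (∪-insertˡ v ys τ)) (insert-comm y v (ys ∪ τ))

filterB-insert-∪ : ∀ (p : ℕ → Bool) v L τ → p v ≡ true → filterB p (insert v L) ∪ τ ≡ insert v (filterB p L ∪ τ)
filterB-insert-∪ p v [] τ pv rewrite pv = refl
filterB-insert-∪ p v (y ∷ ys) τ pv with v <ᵇ y
... | true rewrite pv = refl
... | false with p y
...   | true  = trans (cong (insert y) (filterB-insert-∪ p v ys τ pv)) (insert-comm y v (filterB p ys ∪ τ))
...   | false = filterB-insert-∪ p v ys τ pv

insert-∪-move : ∀ v ρ τ → insert v ρ ∪ τ ≡ ρ ∪ insert v τ
insert-∪-move v ρ τ = trans (∪-insertˡ v ρ τ) (sym (∪-insertʳ v ρ τ))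

remove-insert-∪-move : ∀ v w ρ τ → (v ≡ᵇ w) ≡ false → remove w (insert v ρ) ∪ τ ≡ remove w ρ ∪ insert v τ
remove-insert-∪-move v w ρ τ v≢w =
  trans (filterB-insert-∪ (λ x → not (x ≡ᵇ w)) v ρ τ (cong not v≢w)) (sym (∪-insertʳ v (remove w ρ) τ))

∉ᵇ⇒remove-all : ∀ v ρ → (v ∈ᵇ ρ) ≡ false → All (λ y → not (y ≡ᵇ v) ≡ true) ρ
∉ᵇ⇒remove-all v [] _ = []
∉ᵇ⇒remove-all v (y ∷ ys) v∉ =
  cong not (trans (≡ᵇ-sym y v) (∨-conicalˡ _ _ v∉)) ∷ ∉ᵇ⇒remove-all v ys (∨-conicalʳ _ _ v∉)

remove-insert : ∀ v ρ → (v ∈ᵇ ρ) ≡ false → remove v (insert v ρ) ≡ ρ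
remove-insert v ρ v∉ρ =
  trans (filterB-insert-reject (λ x → not (x ≡ᵇ v)) v ρ (cong not (≡ᵇ-refl v)))
        (filterB-accept _ ρ (∉ᵇ⇒remove-all v ρ v∉ρ))

filterB-nonempty⇒Any : ∀ {A : Set} (p : A → Bool) L → 0 < length (filterB p L) → Any (λ x → p x ≡ true) L
filterB-nonempty⇒Any p (x ∷ xs) nonempty with p x in px
... | true  = here px
... | false = there (filterB-nonempty⇒Any p xs nonempty)

All-filterB : ∀ {A : Set} {P : A → Set} (p : A → Bool) {L} → All P L → All P (filterB p L)
All-filterB p [] = []
All-filterB p {x ∷ xs} (px ∷ pxs) with p x
... | true  = px ∷ All-filterB p pxs
... | false = All-filterB p pxs

All-filterB-accepted : ∀ {A : Set} (p : A → Bool) L → All (λ x → p x ≡ true) (filterB p L)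
All-filterB-accepted p [] = []
All-filterB-accepted p (x ∷ xs) with p x in px
... | true  = px ∷ All-filterB-accepted p xs
... | false = All-filterB-accepted p xs

sorted-filterB : ∀ (p : ℕ → Bool) {L} → AllPairs _<_ L → AllPairs _<_ (filterB p L)
sorted-filterB p [] = []
sorted-filterB p {x ∷ xs} (x<xs ∷ s) with p x
... | true  = All-filterB p x<xs ∷ sorted-filterB p s
... | false = sorted-filterB p s

All-insert : ∀ {P : ℕ → Set} v L → P v → All P L → All P (insert v L)
All-insert v [] pv [] = pv ∷ []
All-insert v (y ∷ ys) pv (py ∷ pys) with v <ᵇ y
... | true  = pv ∷ py ∷ pys
... | false = py ∷ All-insert v ys pv pys

sorted-insert : ∀ v {L} → AllPairs _<_ L → (v ∈ᵇ L) ≡ false → AllPairs _<_ (insert v L)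
sorted-insert v [] _ = [] ∷ []
sorted-insert v {y ∷ ys} (y<ys ∷ s) v∉ with v <ᵇ y | <ᵇ-reflects-< v y
... | true  | ofʸ v<y = (v<y ∷ All.map (<-trans v<y) y<ys) ∷ y<ys ∷ s
... | false | ofⁿ v≮y = All-insert v ys y<v y<ys ∷ sorted-insert v s (∨-conicalʳ _ _ v∉)
  where
  y<v : y < v
  y<v with <-cmp y v
  ... | tri< y<v _ _ = y<v
  ... | tri≈ _ refl _ with () ← trans (sym (≡ᵇ-refl v)) (∨-conicalˡ _ _ v∉)
  ... | tri> _ _ v<y = contradiction v<y v≮y

head-∉ᵇ : ∀ {a as} → All (a <_) as → (a ∈ᵇ as) ≡ false
head-∉ᵇ [] = refl
head-∉ᵇ (a<y ∷ a<ys) rewrite <⇒≢ᵇ a<y = head-∉ᵇ a<ys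

∈ᵇ-lower-bound : ∀ {b bs x} → All (b <_) bs → (x ∈ᵇ bs) ≡ true → b < x
∈ᵇ-lower-bound {bs = y ∷ _} {x} (b<y ∷ b<ys) x∈ with x ≡ᵇ y | ≡ᵇ-reflects-≡ x y
... | true  | ofʸ refl = b<y
... | false | _        = ∈ᵇ-lower-bound b<ys x∈

∈ᵇ-head : ∀ a as → (a ∈ᵇ (a ∷ as)) ≡ true
∈ᵇ-head a as = cong (_∨ (a ∈ᵇ as)) (≡ᵇ-refl a)

∈ᵇ-self : ∀ L → All (λ v → (v ∈ᵇ L) ≡ true) L
∈ᵇ-self [] = []
∈ᵇ-self (x ∷ xs) =
  ∈ᵇ-head x xs ∷ All.map (λ {y} y∈ → trans (cong ((y ≡ᵇ x) ∨_) y∈) (∨-zeroʳ (y ≡ᵇ x))) (∈ᵇ-self xs)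

sorted-extensional : ∀ {A B} → AllPairs _<_ A → AllPairs _<_ B →
                     (∀ x → (x ∈ᵇ A) ≡ (x ∈ᵇ B)) → A ≡ B
sorted-extensional [] [] _ = refl
sorted-extensional [] (_∷_ {b} {bs} _ _) A≈B with () ← trans (A≈B b) (∈ᵇ-head b bs)
sorted-extensional (_∷_ {a} {as} _ _) [] A≈B with () ← trans (sym (A≈B a)) (∈ᵇ-head a as)
sorted-extensional (_∷_ {a} {as} a<as sa) (_∷_ {b} {bs} b<bs sb) A≈B with <-cmp a b
... | tri< a<b _ _ = contradiction (∈ᵇ-lower-bound b<bs a∈bs) (<-asym a<b)
  where
  a∈bs : (a ∈ᵇ bs) ≡ true
  a∈bs = trans (sym (cong (_∨ (a ∈ᵇ bs)) (<⇒≢ᵇ a<b))) (trans (sym (A≈B a)) (∈ᵇ-head a as))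
... | tri> _ _ b<a = contradiction (∈ᵇ-lower-bound a<as b∈as) (<-asym b<a)
  where
  b∈as : (b ∈ᵇ as) ≡ true
  b∈as = trans (sym (cong (_∨ (b ∈ᵇ as)) (<⇒≢ᵇ b<a))) (trans (A≈B b) (∈ᵇ-head b bs))
... | tri≈ _ refl _ = cong (a ∷_) (sorted-extensional sa sb as≈bs)
  where
  as≈bs : ∀ x → (x ∈ᵇ as) ≡ (x ∈ᵇ bs)
  as≈bs x with x ≡ᵇ a in x≡ᵇa | ≡ᵇ-reflects-≡ x a
  ... | true  | ofʸ refl = trans (head-∉ᵇ a<as) (sym (head-∉ᵇ b<bs))
  ... | false | _ = trans (cong (_∨ (x ∈ᵇ as)) (sym x≡ᵇa)) (trans (A≈B x) (cong (_∨ (x ∈ᵇ bs)) x≡ᵇa))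

∈ᵇ-filterB : ∀ (p : ℕ → Bool) w L → (w ∈ᵇ filterB p L) ≡ (p w ∧ (w ∈ᵇ L))
∈ᵇ-filterB p w [] = sym (∧-zeroʳ (p w))
∈ᵇ-filterB p w (x ∷ xs) with w ≡ᵇ x | ≡ᵇ-reflects-≡ w x
... | true | ofʸ refl with p w in pw
...   | true  = cong (_∨ (w ∈ᵇ filterB p xs)) (≡ᵇ-refl w)
...   | false = trans (∈ᵇ-filterB p w xs) (cong (_∧ _) pw)
∈ᵇ-filterB p w (x ∷ xs) | false | ofⁿ w≢x with p x
...   | true  rewrite ≢⇒≡ᵇ≡false w≢x = ∈ᵇ-filterB p w xs
...   | false = ∈ᵇ-filterB p w xs

length-remove : ∀ v {S} → AllPairs _<_ S → (v ∈ᵇ S) ≡ true → suc (length (remove v S)) ≡ length S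
length-remove v {y ∷ ys} (y<ys ∷ s) v∈ with v ≡ᵇ y | ≡ᵇ-reflects-≡ v y
... | true | ofʸ refl rewrite ≡ᵇ-refl v =
  cong (suc ∘ length) (filterB-accept _ ys (All.map (λ v<x → cong not (>⇒≢ᵇ v<x)) y<ys))
... | false | ofⁿ v≢y rewrite ≡ᵇ-sym y v | ≢⇒≡ᵇ≡false v≢y = cong suc (length-remove v s v∈)

minus-insert : ∀ F v ρ → (F minus insert v ρ) ≡ remove v (F minus ρ)
minus-insert F v ρ =
  trans (filterB-cong F (λ x → trans (cong not (∈ᵇ-insert x v ρ)) (not-∨ (x ≡ᵇ v) (x ∈ᵇ ρ))))
        (sym (filterB-filterB (λ x → not (x ≡ᵇ v)) (λ x → not (x ∈ᵇ ρ)) F))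

minus-∷ : ∀ F v ρ → (F minus (v ∷ ρ)) ≡ remove v (F minus ρ)
minus-∷ F v ρ =
  trans (filterB-cong F (λ x → not-∨ (x ≡ᵇ v) (x ∈ᵇ ρ)))
        (sym (filterB-filterB (λ x → not (x ≡ᵇ v)) (λ x → not (x ∈ᵇ ρ)) F))

minus-[] : ∀ F → (F minus []) ≡ F
minus-[] F = filterB-accept _ F (All.universal (λ _ → refl) F)

length-minus : ∀ {ρ F} → AllPairs _<_ ρ → AllPairs _<_ F → (ρ ⊆ᵇ F) ≡ true →
               length (F minus ρ) + length ρ ≡ length F
length-minus {[]} {F} [] _ _ = trans (ℕ.+-identityʳ _) (cong length (minus-[] F))
length-minus {y ∷ ys} {F} (y<ys ∷ sρ) sF ρ⊆F = begin
  length (F minus (y ∷ ys)) + suc (length ys) ≡⟨ ℕ.+-suc _ (length ys) ⟩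
  suc (length (F minus (y ∷ ys))) + length ys ≡⟨ cong (λ L → suc (length L) + length ys) (minus-∷ F y ys) ⟩
  suc (length (remove y (F minus ys))) + length ys
    ≡⟨ cong (_+ length ys) (length-remove y (sorted-filterB _ sF) y∈F∖ys) ⟩
  length (F minus ys) + length ys ≡⟨ length-minus sρ sF (∧-conicalʳ _ _ ρ⊆F) ⟩
  length F ∎
  where
  open ≡-Reasoning
  y∈F∖ys : (y ∈ᵇ (F minus ys)) ≡ true
  y∈F∖ys = trans (∈ᵇ-filterB _ y F) (cong₂ _∧_ (cong not (head-∉ᵇ y<ys)) (∧-conicalˡ _ _ ρ⊆F))

-- Finite sums and double counting over subsets

∑ℕ : {A : Set} → List A → (A → ℕ) → ℕ
∑ℕ []       h = 0
∑ℕ (x ∷ xs) h = h x + ∑ℕ xs h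

∑ℕ-++ : ∀ {A : Set} (xs ys : List A) h → ∑ℕ (xs ++ ys) h ≡ ∑ℕ xs h + ∑ℕ ys h
∑ℕ-++ []       ys h = refl
∑ℕ-++ (x ∷ xs) ys h = trans (cong (h x +_) (∑ℕ-++ xs ys h)) (sym (ℕ.+-assoc (h x) _ _))

∑ℕ-map : ∀ {A B : Set} (f : A → B) xs h → ∑ℕ (map f xs) h ≡ ∑ℕ xs (h ∘ f)
∑ℕ-map f []       h = refl
∑ℕ-map f (x ∷ xs) h = cong (h (f x) +_) (∑ℕ-map f xs h)

∑ℕ-cong : ∀ {A : Set} {h₁ h₂ : A → ℕ} xs → All (λ x → h₁ x ≡ h₂ x) xs → ∑ℕ xs h₁ ≡ ∑ℕ xs h₂
∑ℕ-cong []       []         = refl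
∑ℕ-cong (x ∷ xs) (eq ∷ eqs) = cong₂ _+_ eq (∑ℕ-cong xs eqs)

∑ℕ-+ : ∀ {A : Set} xs (h₁ h₂ : A → ℕ) → ∑ℕ xs (λ x → h₁ x + h₂ x) ≡ ∑ℕ xs h₁ + ∑ℕ xs h₂
∑ℕ-+ []       h₁ h₂ = refl
∑ℕ-+ (x ∷ xs) h₁ h₂ = trans (cong (h₁ x + h₂ x +_) (∑ℕ-+ xs h₁ h₂)) (+-interchange (h₁ x) (h₂ x) _ _)

∑ℕ-const : ∀ {A : Set} (xs : List A) c → ∑ℕ xs (λ _ → c) ≡ length xs * c
∑ℕ-const []       c = refl
∑ℕ-const (x ∷ xs) c = cong (c +_) (∑ℕ-const xs c)

∑ℕ-1 : ∀ {A : Set} (xs : List A) → ∑ℕ xs (λ _ → 1) ≡ length xs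
∑ℕ-1 xs = trans (∑ℕ-const xs 1) (ℕ.*-identityʳ (length xs))

*-cross-scaled : ∀ {s} a c₀ d n N₀ → s ≡ a * c₀ → d * n ≡ a * N₀ → s * N₀ ≡ d * c₀ * n
*-cross-scaled a c₀ d n N₀ refl dn≡aN₀ =
  trans (reassoc a c₀ N₀) (trans (cong (c₀ *_) (sym dn≡aN₀)) (sym (reassoc d c₀ n)))
  where
  reassoc : ∀ a c N → a * c * N ≡ c * (a * N)
  reassoc = solve-∀

*-cross-complemented : ∀ s a c₀ d n N₀ → s + a * c₀ ≡ d * c₀ → d * n + a * N₀ ≡ d * N₀ →
                       s * N₀ ≡ d * c₀ * n
*-cross-complemented s a c₀ d n N₀ eq₁ eq₂ = ℕ.+-cancelʳ-≡ (a * c₀ * N₀) _ _ (begin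
  s * N₀ + a * c₀ * N₀      ≡⟨ distrib s a c₀ N₀ ⟩
  (s + a * c₀) * N₀         ≡⟨ cong (_* N₀) eq₁ ⟩
  d * c₀ * N₀               ≡⟨ reassoc d c₀ N₀ ⟩
  c₀ * (d * N₀)             ≡⟨ cong (c₀ *_) eq₂ ⟨
  c₀ * (d * n + a * N₀)     ≡⟨ expand c₀ d n a N₀ ⟩
  d * c₀ * n + a * c₀ * N₀  ∎)
  where
  open ≡-Reasoning
  distrib : ∀ s a c N → s * N + a * c * N ≡ (s + a * c) * N
  distrib = solve-∀
  reassoc : ∀ d c N → d * c * N ≡ c * (d * N)
  reassoc = solve-∀
  expand : ∀ c d n a N → c * (d * n + a * N) ≡ d * c * n + a * c * N
  expand = solve-∀

binomial : ℕ → ℕ → ℕ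
binomial zero    n       = 1
binomial (suc r) zero    = 0
binomial (suc r) (suc n) = binomial r n + binomial (suc r) n

length-combinations : ∀ r (L : List ℕ) → length (combinations r L) ≡ binomial r (length L)
length-combinations zero    L        = refl
length-combinations (suc r) []       = refl
length-combinations (suc r) (x ∷ xs) = begin
  length (map (x ∷_) (combinations r xs) ++ combinations (suc r) xs)
    ≡⟨ List.length-++ (map (x ∷_) (combinations r xs)) ⟩
  length (map (x ∷_) (combinations r xs)) + length (combinations (suc r) xs)
    ≡⟨ cong₂ _+_ (trans (List.length-map (x ∷_) (combinations r xs)) (length-combinations r xs))
                 (length-combinations (suc r) xs) ⟩
  binomial r (length xs) + binomial (suc r) (length xs) ∎
  where open ≡-Reasoning

binomial-pos : ∀ r n → r ≤ n → 0 < binomial r n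
binomial-pos zero    n       _         = s≤s z≤n
binomial-pos (suc r) (suc n) (s≤s r≤n) = ℕ.<-≤-trans (binomial-pos r n r≤n) (ℕ.m≤m+n _ _)

All-combinations : ∀ {P : ℕ → Set} r L → All P L → All (All P) (combinations r L)
All-combinations zero    L        _           = [] ∷ []
All-combinations (suc r) []       _           = []
All-combinations (suc r) (x ∷ xs) (px ∷ pxs) =
  All.++⁺ (All.map⁺ (All.map (px ∷_) (All-combinations r xs pxs))) (All-combinations (suc r) xs pxs)

∑ℕ-combinations-∷ : ∀ r x S (g : List ℕ → ℕ) →
  ∑ℕ (combinations (suc r) (x ∷ S)) g ≡ ∑ℕ (combinations r S) (g ∘ (x ∷_)) + ∑ℕ (combinations (suc r) S) g
∑ℕ-combinations-∷ r x S g =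
  trans (∑ℕ-++ (map (x ∷_) (combinations r S)) (combinations (suc r) S) g)
        (cong (_+ _) (∑ℕ-map (x ∷_) (combinations r S) g))

insert-below : ∀ {x} τ → All (x <_) τ → insert x τ ≡ x ∷ τ
insert-below []      []        = refl
insert-below (y ∷ _) (x<y ∷ _) rewrite <⇒<ᵇ≡true x<y = refl

insert-above : ∀ {x v} τ → x < v → insert v (x ∷ τ) ≡ x ∷ insert v τ
insert-above τ x<v rewrite ≮⇒<ᵇ≡false (<-asym x<v) = refl

remove-head : ∀ x S → All (x <_) S → remove x (x ∷ S) ≡ S
remove-head x S x<S rewrite ≡ᵇ-refl x = filterB-accept _ S (All.map (λ x<y → cong not (>⇒≢ᵇ x<y)) x<S)

remove-below : ∀ {x v} S → x < v → remove v (x ∷ S) ≡ x ∷ remove v S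
remove-below S x<v rewrite <⇒≢ᵇ x<v = refl

∑ℕ-singletons : ∀ S (g : List ℕ → ℕ) → ∑ℕ S (λ v → g (v ∷ []) + 0) ≡ ∑ℕ (combinations 1 S) g
∑ℕ-singletons []      g = refl
∑ℕ-singletons (x ∷ S) g = cong₂ _+_ (ℕ.+-identityʳ (g (x ∷ []))) (∑ℕ-singletons S g)

∑ℕ-choose-insert : ∀ r S (g : List ℕ → ℕ) → AllPairs _<_ S →
  ∑ℕ S (λ v → ∑ℕ (combinations r (remove v S)) (g ∘ insert v)) ≡ suc r * ∑ℕ (combinations (suc r) S) g
∑ℕ-choose-insert zero    S        g _ = trans (∑ℕ-singletons S g) (sym (ℕ.+-identityʳ _))
∑ℕ-choose-insert (suc r) []       g _ = sym (ℕ.*-zeroʳ (suc (suc r)))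
∑ℕ-choose-insert (suc r) (x ∷ S) g (x<S ∷ sorted-S) = begin
  ∑ℕ (combinations (suc r) (remove x (x ∷ S))) (g ∘ insert x) +
  ∑ℕ S (λ v → ∑ℕ (combinations (suc r) (remove v (x ∷ S))) (g ∘ insert v))
    ≡⟨ cong₂ _+_ head-term (∑ℕ-cong S (All.map split x<S)) ⟩
  A + ∑ℕ S (λ v → P v + Q v)
    ≡⟨ cong (A +_) (∑ℕ-+ S P Q) ⟩
  A + (∑ℕ S P + ∑ℕ S Q)
    ≡⟨ cong (A +_) (cong₂ _+_ (∑ℕ-choose-insert r S (g ∘ (x ∷_)) sorted-S)
                              (∑ℕ-choose-insert (suc r) S g sorted-S)) ⟩
  A + (suc r * A + suc (suc r) * B)
    ≡⟨ collect (suc r) A B ⟩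
  suc (suc r) * (A + B)
    ≡⟨ cong (suc (suc r) *_) (sym (∑ℕ-combinations-∷ (suc r) x S g)) ⟩
  suc (suc r) * ∑ℕ (combinations (suc (suc r)) (x ∷ S)) g ∎
  where
  open ≡-Reasoning
  A = ∑ℕ (combinations (suc r) S) (g ∘ (x ∷_))
  B = ∑ℕ (combinations (suc (suc r)) S) g
  P Q : ℕ → ℕ
  P v = ∑ℕ (combinations r (remove v S)) (λ τ → g (x ∷ insert v τ))
  Q v = ∑ℕ (combinations (suc r) (remove v S)) (g ∘ insert v)
  collect : ∀ r A B → A + (r * A + suc r * B) ≡ suc r * (A + B)
  collect = solve-∀
  head-term : ∑ℕ (combinations (suc r) (remove x (x ∷ S))) (g ∘ insert x) ≡ A
  head-term rewrite remove-head x S x<S =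
    ∑ℕ-cong (combinations (suc r) S) (All.map (cong g ∘ insert-below _) (All-combinations (suc r) S x<S))
  split : ∀ {v} → x < v → ∑ℕ (combinations (suc r) (remove v (x ∷ S))) (g ∘ insert v) ≡ P v + Q v
  split {v} x<v rewrite remove-below S x<v =
    trans (∑ℕ-combinations-∷ r x (remove v S) (g ∘ insert v))
          (cong (_+ Q v) (∑ℕ-cong (combinations r (remove v S))
                             (All.universal (λ τ → cong g (insert-above τ x<v)) _)))

∑ℕ-choose-remove : ∀ r S (g : List ℕ → ℕ) → AllPairs _<_ S →
  ∑ℕ S (λ v → ∑ℕ (combinations r (remove v S)) g) + r * ∑ℕ (combinations r S) g
    ≡ length S * ∑ℕ (combinations r S) g
∑ℕ-choose-remove zero    S        g _ = trans (ℕ.+-identityʳ _) (∑ℕ-const S (g [] + 0))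
∑ℕ-choose-remove (suc r) []       g _ = ℕ.*-zeroʳ (suc r)
∑ℕ-choose-remove (suc r) (x ∷ S) g (x<S ∷ sorted-S) = begin
  (∑ℕ (combinations (suc r) (remove x (x ∷ S))) g +
   ∑ℕ S (λ v → ∑ℕ (combinations (suc r) (remove v (x ∷ S))) g)) +
  suc r * ∑ℕ (combinations (suc r) (x ∷ S)) g
    ≡⟨ cong₂ (λ s t → s + suc r * t)
             (cong₂ _+_ (cong (λ T → ∑ℕ (combinations (suc r) T) g) (remove-head x S x<S))
                        (trans (∑ℕ-cong S (All.map split x<S)) (∑ℕ-+ S _ _)))
             (∑ℕ-combinations-∷ r x S g) ⟩
  (B + (XA + XB)) + suc r * (A + B)
    ≡⟨ collect r A B XA XB (length S)
         (∑ℕ-choose-remove r S (g ∘ (x ∷_)) sorted-S) (∑ℕ-choose-remove (suc r) S g sorted-S) ⟩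
  suc (length S) * (A + B)
    ≡⟨ cong (suc (length S) *_) (sym (∑ℕ-combinations-∷ r x S g)) ⟩
  suc (length S) * ∑ℕ (combinations (suc r) (x ∷ S)) g ∎
  where
  open ≡-Reasoning
  A = ∑ℕ (combinations r S) (g ∘ (x ∷_))
  B = ∑ℕ (combinations (suc r) S) g
  XA = ∑ℕ S (λ v → ∑ℕ (combinations r (remove v S)) (g ∘ (x ∷_)))
  XB = ∑ℕ S (λ v → ∑ℕ (combinations (suc r) (remove v S)) g)
  split : ∀ {v} → x < v → ∑ℕ (combinations (suc r) (remove v (x ∷ S))) g ≡
          ∑ℕ (combinations r (remove v S)) (g ∘ (x ∷_)) + ∑ℕ (combinations (suc r) (remove v S)) g
  split {v} x<v rewrite remove-below S x<v = ∑ℕ-combinations-∷ r x (remove v S) g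
  collect : ∀ r A B XA XB n → XA + r * A ≡ n * A → XB + suc r * B ≡ n * B →
            (B + (XA + XB)) + suc r * (A + B) ≡ suc n * (A + B)
  collect r A B XA XB n eqA eqB = begin
    (B + (XA + XB)) + suc r * (A + B)          ≡⟨ regroup r A B XA XB ⟩
    (XA + r * A) + (XB + suc r * B) + (A + B)  ≡⟨ cong₂ (λ s t → s + t + (A + B)) eqA eqB ⟩
    n * A + n * B + (A + B)                    ≡⟨ factor n A B ⟩
    suc n * (A + B)                            ∎
    where
    regroup : ∀ r A B XA XB → (B + (XA + XB)) + suc r * (A + B) ≡
                              (XA + r * A) + (XB + suc r * B) + (A + B)
    regroup = solve-∀
    factor : ∀ n A B → n * A + n * B + (A + B) ≡ suc n * (A + B)
    factor = solve-∀

fromℕ : ℕ → ℚ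
fromℕ n = mkℚ (ℤ.+ n) 0 (coprime-sym (1-coprimeTo n))

frac-suc≃ : ∀ a b → toℚᵘ (frac a (suc b)) ≃ mkℚᵘ (ℤ.+ a) b
frac-suc≃ a b = ℚ.toℚᵘ-fromℚᵘ (mkℚᵘ (ℤ.+ a) b)

frac-cross-mul : ∀ a b c d e → a * suc e ≡ c * d * suc b →
                 frac a (suc b) ≡ fromℕ c ℚ.* frac d (suc e)
frac-cross-mul a b c d e eq = ℚ.toℚᵘ-injective (begin
  toℚᵘ (frac a (suc b))                      ≈⟨ frac-suc≃ a b ⟩
  mkℚᵘ (ℤ.+ a) b                             ≈⟨ *≡* cross ⟩
  mkℚᵘ (ℤ.+ c) 0 ℚᵘ.* mkℚᵘ (ℤ.+ d) e         ≈⟨ ℚᵘ.*-congˡ {mkℚᵘ (ℤ.+ c) 0} (frac-suc≃ d e) ⟨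
  toℚᵘ (fromℕ c) ℚᵘ.* toℚᵘ (frac d (suc e))  ≈⟨ ℚ.toℚᵘ-homo-* (fromℕ c) (frac d (suc e)) ⟨
  toℚᵘ (fromℕ c ℚ.* frac d (suc e))          ∎)
  where
  open ℚᵘ.≃-Reasoning
  cross : ℤ.+ a ℤ.* ℤ.+ (1 * suc e) ≡ ℤ.+ c ℤ.* ℤ.+ d ℤ.* ℤ.+ suc b
  cross = trans (cong (λ n → ℤ.+ a ℤ.* ℤ.+ n) (ℕ.*-identityˡ (suc e)))
          (trans (sym (ℤ.pos-* a (suc e)))
          (trans (cong ℤ.+_ eq)
          (trans (ℤ.pos-* (c * d) (suc b)) (cong (ℤ._* ℤ.+ suc b) (ℤ.pos-* c d)))))

frac≡fromℕ*frac1 : ∀ a b → frac a (suc b) ≡ fromℕ a ℚ.* frac 1 (suc b)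
frac≡fromℕ*frac1 a b = frac-cross-mul a b a 1 b (cong (_* suc b) (sym (ℕ.*-identityʳ a)))

frac*denominator : ∀ a b → frac a (suc b) ℚ.* fromℕ (suc b) ≡ fromℕ a
frac*denominator a b = ℚ.toℚᵘ-injective (begin
  toℚᵘ (frac a (suc b) ℚ.* fromℕ (suc b))        ≈⟨ ℚ.toℚᵘ-homo-* (frac a (suc b)) (fromℕ (suc b)) ⟩
  toℚᵘ (frac a (suc b)) ℚᵘ.* mkℚᵘ (ℤ.+ suc b) 0  ≈⟨ ℚᵘ.*-congʳ {mkℚᵘ (ℤ.+ suc b) 0} (frac-suc≃ a b) ⟩
  mkℚᵘ (ℤ.+ a) b ℚᵘ.* mkℚᵘ (ℤ.+ suc b) 0         ≈⟨ *≡* cross ⟩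
  toℚᵘ (fromℕ a)                                 ∎)
  where
  open ℚᵘ.≃-Reasoning
  cross : (ℤ.+ a ℤ.* ℤ.+ suc b) ℤ.* ℤ.+ 1 ≡ ℤ.+ a ℤ.* ℤ.+ (suc b * 1)
  cross = trans (ℤ.*-identityʳ _) (cong (λ n → ℤ.+ a ℤ.* ℤ.+ n) (sym (ℕ.*-identityʳ (suc b))))

fromℕ-+ : ∀ m n → fromℕ (m + n) ≡ fromℕ m ℚ.+ fromℕ n
fromℕ-+ m n = ℚ.toℚᵘ-injective (ℚᵘ.≃-sym (ℚᵘ.≃-trans (ℚ.toℚᵘ-homo-+ (fromℕ m) (fromℕ n)) (*≡* cross)))
  where
  cross : (ℤ.+ m ℤ.* ℤ.+ 1 ℤ.+ ℤ.+ n ℤ.* ℤ.+ 1) ℤ.* ℤ.+ 1 ≡ ℤ.+ (m + n) ℤ.* ℤ.+ 1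
  cross rewrite ℤ.*-identityʳ (ℤ.+ m) | ℤ.*-identityʳ (ℤ.+ n) = cong (ℤ._* ℤ.+ 1) (sym (ℤ.pos-+ m n))

∑ℚ : {A : Set} → List A → (A → ℚ) → ℚ
∑ℚ []       h = 0ℚ
∑ℚ (x ∷ xs) h = h x ℚ.+ ∑ℚ xs h

sumℚ-map : ∀ {A : Set} (h : A → ℚ) xs → sumℚ (map h xs) ≡ ∑ℚ xs h
sumℚ-map h []       = refl
sumℚ-map h (x ∷ xs) = cong (h x ℚ.+_) (sumℚ-map h xs)

∑ℚ-cong : ∀ {A : Set} {h₁ h₂ : A → ℚ} xs → All (λ x → h₁ x ≡ h₂ x) xs → ∑ℚ xs h₁ ≡ ∑ℚ xs h₂
∑ℚ-cong []       []         = refl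
∑ℚ-cong (x ∷ xs) (eq ∷ eqs) = cong₂ ℚ._+_ eq (∑ℚ-cong xs eqs)

∑ℚ-cong′ : ∀ {A : Set} {h₁ h₂ : A → ℚ} xs → (∀ x → h₁ x ≡ h₂ x) → ∑ℚ xs h₁ ≡ ∑ℚ xs h₂
∑ℚ-cong′ xs h₁≗h₂ = ∑ℚ-cong xs (All.universal h₁≗h₂ xs)

∑ℚ-+ : ∀ {A : Set} xs (h₁ h₂ : A → ℚ) → ∑ℚ xs (λ x → h₁ x ℚ.+ h₂ x) ≡ ∑ℚ xs h₁ ℚ.+ ∑ℚ xs h₂
∑ℚ-+ []       h₁ h₂ = refl
∑ℚ-+ (x ∷ xs) h₁ h₂ =
  trans (cong (h₁ x ℚ.+ h₂ x ℚ.+_) (∑ℚ-+ xs h₁ h₂)) (+ℚ-interchange (h₁ x) (h₂ x) _ _)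

∑ℚ-*ˡ : ∀ {A : Set} xs q (h : A → ℚ) → ∑ℚ xs (λ x → q ℚ.* h x) ≡ q ℚ.* ∑ℚ xs h
∑ℚ-*ˡ []       q h = sym (ℚ.*-zeroʳ q)
∑ℚ-*ˡ (x ∷ xs) q h = trans (cong (q ℚ.* h x ℚ.+_) (∑ℚ-*ˡ xs q h)) (sym (ℚ.*-distribˡ-+ q (h x) (∑ℚ xs h)))

∑ℚ-*ʳ : ∀ {A : Set} xs q (h : A → ℚ) → ∑ℚ xs (λ x → h x ℚ.* q) ≡ ∑ℚ xs h ℚ.* q
∑ℚ-*ʳ []       q h = sym (ℚ.*-zeroˡ q)
∑ℚ-*ʳ (x ∷ xs) q h = trans (cong (h x ℚ.* q ℚ.+_) (∑ℚ-*ʳ xs q h)) (sym (ℚ.*-distribʳ-+ q (h x) (∑ℚ xs h)))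

∑ℚ-zero : ∀ {A : Set} (xs : List A) → ∑ℚ xs (λ _ → 0ℚ) ≡ 0ℚ
∑ℚ-zero []       = refl
∑ℚ-zero (x ∷ xs) = cong (0ℚ ℚ.+_) (∑ℚ-zero xs)

∑ℚ-swap : ∀ {A B : Set} (xs : List A) (ys : List B) (h : A → B → ℚ) →
          ∑ℚ xs (λ a → ∑ℚ ys (h a)) ≡ ∑ℚ ys (λ b → ∑ℚ xs (λ a → h a b))
∑ℚ-swap []       ys h = sym (∑ℚ-zero ys)
∑ℚ-swap (x ∷ xs) ys h =
  trans (cong (∑ℚ ys (h x) ℚ.+_) (∑ℚ-swap xs ys h)) (sym (∑ℚ-+ ys (h x) (λ b → ∑ℚ xs (λ a → h a b))))

∑ℚ-filterB : ∀ {A : Set} (p : A → Bool) xs (h : A → ℚ) →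
             ∑ℚ (filterB p xs) h ≡ ∑ℚ xs (λ x → if p x then h x else 0ℚ)
∑ℚ-filterB p []       h = refl
∑ℚ-filterB p (x ∷ xs) h with p x
... | true  = cong (h x ℚ.+_) (∑ℚ-filterB p xs h)
... | false = trans (∑ℚ-filterB p xs h) (sym (ℚ.+-identityˡ _))

∑ℚ-insert : ∀ v L (h : ℕ → ℚ) → ∑ℚ (insert v L) h ≡ h v ℚ.+ ∑ℚ L h
∑ℚ-insert v []       h = refl
∑ℚ-insert v (y ∷ ys) h with v <ᵇ y
... | true  = refl
... | false = trans (cong (h y ℚ.+_) (∑ℚ-insert v ys h)) (+ℚ-swap (h y) (h v) (∑ℚ ys h))

∑ℚ-mono : ∀ {A : Set} {h₁ h₂ : A → ℚ} xs → All (λ x → h₁ x ℚ.≤ h₂ x) xs → ∑ℚ xs h₁ ℚ.≤ ∑ℚ xs h₂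
∑ℚ-mono []       []         = ℚ.≤-refl
∑ℚ-mono (x ∷ xs) (le ∷ les) = ℚ.+-mono-≤ le (∑ℚ-mono xs les)

∑ℚ-fromℕ : ∀ {A : Set} xs (h : A → ℕ) → ∑ℚ xs (fromℕ ∘ h) ≡ fromℕ (∑ℕ xs h)
∑ℚ-fromℕ []       h = refl
∑ℚ-fromℕ (x ∷ xs) h = trans (cong (fromℕ (h x) ℚ.+_) (∑ℚ-fromℕ xs h)) (sym (fromℕ-+ (h x) (∑ℕ xs h)))

∑ℚ-frac-common-denominator : ∀ {A : Set} xs (c N : A → ℕ) n c₀ N₀ d → All (λ x → N x ≡ n) xs →
  0 < n → 0 < N₀ → ∑ℕ xs c * N₀ ≡ d * c₀ * n →
  ∑ℚ xs (λ x → frac (c x) (N x)) ≡ fromℕ d ℚ.* frac c₀ N₀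
∑ℚ-frac-common-denominator xs c N (suc n) c₀ (suc N₀) d N≡n _ _ eq = begin
  ∑ℚ xs (λ x → frac (c x) (N x))
    ≡⟨ ∑ℚ-cong xs (All.map (λ {x} Nx≡n → trans (cong (frac (c x)) Nx≡n) (frac≡fromℕ*frac1 (c x) n)) N≡n) ⟩
  ∑ℚ xs (λ x → fromℕ (c x) ℚ.* frac 1 (suc n)) ≡⟨ ∑ℚ-*ʳ xs (frac 1 (suc n)) (fromℕ ∘ c) ⟩
  ∑ℚ xs (fromℕ ∘ c) ℚ.* frac 1 (suc n)         ≡⟨ cong (ℚ._* frac 1 (suc n)) (∑ℚ-fromℕ xs c) ⟩
  fromℕ (∑ℕ xs c) ℚ.* frac 1 (suc n)           ≡⟨ frac≡fromℕ*frac1 (∑ℕ xs c) n ⟨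
  frac (∑ℕ xs c) (suc n)                       ≡⟨ frac-cross-mul (∑ℕ xs c) n d c₀ N₀ eq ⟩
  fromℕ d ℚ.* frac c₀ (suc N₀)                 ∎
  where open ≡-Reasoning

fromℕ-nonNeg : ∀ n → ℚ.NonNegative (fromℕ n)
fromℕ-nonNeg n = _

frac1-nonNeg : ∀ n → ℚ.NonNegative (frac 1 n)
frac1-nonNeg zero    = _
frac1-nonNeg (suc n) = ℚ.normalize-nonNeg 1 (suc n)

frac1*denominator : ∀ n → frac 1 (suc n) ℚ.* fromℕ (suc n) ≡ 1ℚ
frac1*denominator = frac*denominator 1

≤-avg⇒≤-sum : ∀ a b n m → 0 < n → 0 < m → a ℚ.* frac 1 n ℚ.≤ 1ℚ ℚ.* (b ℚ.* frac 1 n ℚ.* frac 1 m) →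
              fromℕ m ℚ.* a ℚ.≤ b
≤-avg⇒≤-sum a b (suc n) (suc s) _ _ a/n≤b/ns = begin
  fromℕ (suc s) ℚ.* a                           ≡⟨ lhs ⟩
  a ℚ.* frac 1 (suc n) ℚ.* (N ℚ.* S)
    ≤⟨ ℚ.*-monoʳ-≤-nonNeg (N ℚ.* S) {{ℚ.nonNeg*nonNeg⇒nonNeg N {{fromℕ-nonNeg _}} S {{fromℕ-nonNeg _}}}}
                          a/n≤b/ns ⟩
  1ℚ ℚ.* (b ℚ.* frac 1 (suc n) ℚ.* frac 1 (suc s)) ℚ.* (N ℚ.* S) ≡⟨ rhs ⟩
  b                                             ∎
  where
  open ℚ.≤-Reasoning
  N = fromℕ (suc n)
  S = fromℕ (suc s)
  lhs : S ℚ.* a ≡ a ℚ.* frac 1 (suc n) ℚ.* (N ℚ.* S)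
  lhs = begin-equality
    S ℚ.* a                                    ≡⟨ ℚ.*-identityʳ (S ℚ.* a) ⟨
    S ℚ.* a ℚ.* 1ℚ                             ≡⟨ cong (S ℚ.* a ℚ.*_) (frac1*denominator n) ⟨
    S ℚ.* a ℚ.* (frac 1 (suc n) ℚ.* N)
      ≡⟨ solve 4 (λ S a f N → S :* a :* (f :* N) := a :* f :* (N :* S)) refl S a (frac 1 (suc n)) N ⟩
    a ℚ.* frac 1 (suc n) ℚ.* (N ℚ.* S)         ∎
  rhs : 1ℚ ℚ.* (b ℚ.* frac 1 (suc n) ℚ.* frac 1 (suc s)) ℚ.* (N ℚ.* S) ≡ b
  rhs = begin-equality
    1ℚ ℚ.* (b ℚ.* frac 1 (suc n) ℚ.* frac 1 (suc s)) ℚ.* (N ℚ.* S)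
      ≡⟨ solve 5 (λ b f g N S → con 1ℚ :* (b :* f :* g) :* (N :* S) := b :* (f :* N) :* (g :* S))
               refl b (frac 1 (suc n)) (frac 1 (suc s)) N S ⟩
    b ℚ.* (frac 1 (suc n) ℚ.* N) ℚ.* (frac 1 (suc s) ℚ.* S)
      ≡⟨ cong₂ (λ x y → b ℚ.* x ℚ.* y) (frac1*denominator n) (frac1*denominator s) ⟩
    b ℚ.* 1ℚ ℚ.* 1ℚ                            ≡⟨ trans (ℚ.*-identityʳ _) (ℚ.*-identityʳ b) ⟩
    b                                          ∎

≤-sum⇒≤-avg : ∀ a b n m → 0 < m → fromℕ m ℚ.* a ℚ.≤ b →
              a ℚ.* frac 1 n ℚ.≤ 1ℚ ℚ.* (b ℚ.* frac 1 n ℚ.* frac 1 m)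
≤-sum⇒≤-avg a b n (suc s) _ sa≤b = begin
  a ℚ.* frac 1 n                                        ≡⟨ lhs ⟩
  fromℕ (suc s) ℚ.* a ℚ.* frac 1 n ℚ.* frac 1 (suc s)
    ≤⟨ ℚ.*-monoʳ-≤-nonNeg (frac 1 (suc s)) {{frac1-nonNeg (suc s)}}
         (ℚ.*-monoʳ-≤-nonNeg (frac 1 n) {{frac1-nonNeg n}} sa≤b) ⟩
  b ℚ.* frac 1 n ℚ.* frac 1 (suc s)                     ≡⟨ ℚ.*-identityˡ _ ⟨
  1ℚ ℚ.* (b ℚ.* frac 1 n ℚ.* frac 1 (suc s))            ∎
  where
  open ℚ.≤-Reasoning
  lhs : a ℚ.* frac 1 n ≡ fromℕ (suc s) ℚ.* a ℚ.* frac 1 n ℚ.* frac 1 (suc s)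
  lhs = begin-equality
    a ℚ.* frac 1 n                                      ≡⟨ ℚ.*-identityʳ _ ⟨
    a ℚ.* frac 1 n ℚ.* 1ℚ                               ≡⟨ cong (a ℚ.* frac 1 n ℚ.*_) (frac1*denominator s) ⟨
    a ℚ.* frac 1 n ℚ.* (frac 1 (suc s) ℚ.* fromℕ (suc s))
      ≡⟨ solve 4 (λ a f g S → a :* f :* (g :* S) := S :* a :* f :* g) refl a (frac 1 n) (frac 1 (suc s)) (fromℕ (suc s)) ⟩
    fromℕ (suc s) ℚ.* a ℚ.* frac 1 n ℚ.* frac 1 (suc s) ∎

cancel-common-summand : ∀ m D A B →
  fromℕ (suc (suc m)) ℚ.* (fromℕ (suc D) ℚ.* A) ℚ.≤ fromℕ (suc D) ℚ.* A ℚ.+ fromℕ (suc D) ℚ.* B →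
  fromℕ (suc m) ℚ.* A ℚ.≤ B
cancel-common-summand m D A B hyp = begin
  fromℕ (suc m) ℚ.* A
    ≡⟨ solve 2 (λ M A → M :* A := (con 1ℚ :+ M) :* A :+ (:- A)) refl (fromℕ (suc m)) A ⟩
  (1ℚ ℚ.+ fromℕ (suc m)) ℚ.* A ℚ.+ ℚ.- A
    ≤⟨ ℚ.+-monoˡ-≤ (ℚ.- A) (subst (λ M → M ℚ.* A ℚ.≤ A ℚ.+ B) (fromℕ-+ 1 (suc m)) cancelled) ⟩
  A ℚ.+ B ℚ.+ ℚ.- A
    ≡⟨ solve 2 (λ A B → A :+ B :+ (:- A) := B) refl A B ⟩
  B ∎
  where
  open ℚ.≤-Reasoning
  d = fromℕ (suc D)
  cancelled : fromℕ (suc (suc m)) ℚ.* A ℚ.≤ A ℚ.+ B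
  cancelled = ℚ.*-cancelˡ-≤-pos d {{_}} (subst₂ ℚ._≤_
    (solve 3 (λ M d A → M :* (d :* A) := d :* (M :* A)) refl (fromℕ (suc (suc m))) d A)
    (sym (ℚ.*-distribˡ-+ d A B)) hyp)

-- Densities on the facets through a face

indicator : Bool → ℕ
indicator b = if b then 1 else 0

count≡∑indicator : ∀ (g : List ℕ → Bool) xs → count g xs ≡ ∑ℕ xs (indicator ∘ g)
count≡∑indicator g []       = refl
count≡∑indicator g (x ∷ xs) with g x
... | true  = cong suc (count≡∑indicator g xs)
... | false = count≡∑indicator g xs

density : ℕ → (List ℕ → Bool) → List ℕ → ℚ
density r g T = frac (count g (combinations r T)) (length (combinations r T))

module FacetDensities (f : Cochain) (ρ F : List ℕ) (r D : ℕ) (sorted-F : AllPairs _<_ F)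
                      (|F∖ρ| : length (F minus ρ) ≡ suc D) (r<D : suc r ≤ D) where

  S : List ℕ
  S = F minus ρ

  sorted-S : AllPairs _<_ S
  sorted-S = sorted-filterB _ sorted-F

  S∌ρ : All (λ v → (v ∈ᵇ ρ) ≡ false) S
  S∌ρ = All.map not-injective (All-filterB-accepted (λ x → not (x ∈ᵇ ρ)) F)

  choose-S : ∀ R → length (combinations R S) ≡ binomial R (suc D)
  choose-S R = trans (length-combinations R S) (cong (binomial R) |F∖ρ|)

  choose-S∖v : ∀ R {v} → (v ∈ᵇ S) ≡ true → length (combinations R (remove v S)) ≡ binomial R D
  choose-S∖v R {v} v∈S =
    trans (length-combinations R (remove v S))
          (cong (binomial R) (ℕ.suc-injective (trans (length-remove v sorted-S v∈S) |F∖ρ|)))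

  link≡S∖v : ∀ v → F minus insert v ρ ≡ remove v S
  link≡S∖v v = minus-insert F v ρ

  count-link : ∀ R g v → count g (combinations R (F minus insert v ρ)) ≡ ∑ℕ (combinations R (remove v S)) (indicator ∘ g)
  count-link R g v = trans (cong (count g ∘ combinations R) (link≡S∖v v)) (count≡∑indicator g (combinations R (remove v S)))

  ∑-choose-S∖v : ∀ R → ∑ℕ S (λ v → ∑ℕ (combinations R (remove v S)) (λ _ → 1)) ≡ suc D * binomial R D
  ∑-choose-S∖v R = begin
    ∑ℕ S (λ v → ∑ℕ (combinations R (remove v S)) (λ _ → 1))
      ≡⟨ ∑ℕ-cong S (All.map (λ {v} v∈S → trans (∑ℕ-1 (combinations R (remove v S))) (choose-S∖v R v∈S))
                            (∈ᵇ-self S)) ⟩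
    ∑ℕ S (λ _ → binomial R D)  ≡⟨ ∑ℕ-const S (binomial R D) ⟩
    length S * binomial R D  ≡⟨ cong (_* binomial R D) |F∖ρ| ⟩
    suc D * binomial R D     ∎
    where open ≡-Reasoning

  binomial-absorption : ∀ R → suc D * binomial R D ≡ suc R * binomial (suc R) (suc D)
  binomial-absorption R =
    trans (sym (∑-choose-S∖v R))
          (trans (∑ℕ-choose-insert R S (λ _ → 1) sorted-S)
                 (cong (suc R *_) (trans (∑ℕ-1 (combinations (suc R) S)) (choose-S (suc R)))))

  binomial-complement : ∀ R → suc D * binomial R D + R * binomial R (suc D) ≡ suc D * binomial R (suc D)
  binomial-complement R =
    trans (cong₂ _+_ (sym (∑-choose-S∖v R)) (cong (R *_) (sym |choose-S|)))
          (trans (∑ℕ-choose-remove R S (λ _ → 1) sorted-S) (cong₂ _*_ |F∖ρ| |choose-S|))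
    where
    |choose-S| : ∑ℕ (combinations R S) (λ _ → 1) ≡ binomial R (suc D)
    |choose-S| = trans (∑ℕ-1 (combinations R S)) (choose-S R)

  ∑-density-link : ∀ R R′ (g : ℕ → List ℕ → Bool) (g₀ : List ℕ → Bool) → R ≤ D → R′ ≤ suc D →
    ∑ℕ S (λ v → count (g v) (combinations R (F minus insert v ρ))) * binomial R′ (suc D)
      ≡ suc D * count g₀ (combinations R′ S) * binomial R D →
    ∑ℚ S (λ v → density R (g v) (F minus insert v ρ)) ≡ fromℕ (suc D) ℚ.* density R′ g₀ S
  ∑-density-link R R′ g g₀ R≤D R′≤1+D eq =
    ∑ℚ-frac-common-denominator S _ _ (binomial R D) _ _ (suc D)
      (All.map (λ {v} v∈S → trans (cong (length ∘ combinations R) (link≡S∖v v)) (choose-S∖v R v∈S)) (∈ᵇ-self S))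
      (binomial-pos R D R≤D)
      (subst (0 <_) (sym (choose-S R′)) (binomial-pos R′ (suc D) R′≤1+D))
      (subst (λ N → ∑ℕ S (λ v → count (g v) (combinations R (F minus insert v ρ))) * N
                    ≡ suc D * count g₀ (combinations R′ S) * binomial R D) (sym (choose-S R′)) eq)

  ∑-count-link : ∀ R (g : ℕ → List ℕ → Bool) (h : ℕ → List ℕ → ℕ) →
    All (λ v → ∀ τ → indicator (g v τ) ≡ h v τ) S →
    ∑ℕ S (λ v → count (g v) (combinations R (F minus insert v ρ)))
      ≡ ∑ℕ S (λ v → ∑ℕ (combinations R (remove v S)) (h v))
  ∑-count-link R g h g≗h = ∑ℕ-cong S (All.map (λ {v} g≗hᵥ →
    trans (count-link R (g v) v) (∑ℕ-cong (combinations R (remove v S)) (All.universal g≗hᵥ _))) g≗h)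

  ∑-density-localize :
    ∑ℚ S (λ v → density r (λ τ → f (insert v ρ ∪ τ)) (F minus insert v ρ))
      ≡ fromℕ (suc D) ℚ.* density (suc r) (λ τ → f (ρ ∪ τ)) S
  ∑-density-localize =
    ∑-density-link r (suc r) g (λ τ → f (ρ ∪ τ)) (ℕ.<⇒≤ r<D) (s≤s (ℕ.<⇒≤ r<D))
      (*-cross-scaled (suc r) c₀ (suc D) (binomial r D) (binomial (suc r) (suc D)) ∑counts (binomial-absorption r))
    where
    open ≡-Reasoning
    g : ℕ → List ℕ → Bool
    g v τ = f (insert v ρ ∪ τ)
    c₀ = count (λ τ → f (ρ ∪ τ)) (combinations (suc r) S)
    𝟙f : List ℕ → ℕ
    𝟙f τ = indicator (f (ρ ∪ τ))
    ∑counts : ∑ℕ S (λ v → count (g v) (combinations r (F minus insert v ρ))) ≡ suc r * c₀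
    ∑counts = begin
      ∑ℕ S (λ v → count (g v) (combinations r (F minus insert v ρ)))
        ≡⟨ ∑-count-link r g (λ v → 𝟙f ∘ insert v)
             (All.universal (λ v τ → cong (indicator ∘ f) (insert-∪-move v ρ τ)) S) ⟩
      ∑ℕ S (λ v → ∑ℕ (combinations r (remove v S)) (𝟙f ∘ insert v))
        ≡⟨ ∑ℕ-choose-insert r S 𝟙f sorted-S ⟩
      suc r * ∑ℕ (combinations (suc r) S) 𝟙f
        ≡⟨ cong (suc r *_) (count≡∑indicator (λ τ → f (ρ ∪ τ)) (combinations (suc r) S)) ⟨
      suc r * c₀ ∎

  ∑-density-restrict-new :
    ∑ℚ S (λ v → density (suc r) (λ τ → f (remove v (insert v ρ) ∪ τ)) (F minus insert v ρ))
      ≡ fromℕ (suc D) ℚ.* density (suc r) (λ τ → f (ρ ∪ τ)) S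
  ∑-density-restrict-new =
    ∑-density-link (suc r) (suc r) g (λ τ → f (ρ ∪ τ)) r<D (s≤s (ℕ.<⇒≤ r<D))
      (*-cross-complemented (∑ℕ S (λ v → count (g v) (combinations (suc r) (F minus insert v ρ)))) (suc r) c₀ (suc D)
        (binomial (suc r) D) (binomial (suc r) (suc D)) ∑counts (binomial-complement (suc r)))
    where
    open ≡-Reasoning
    g : ℕ → List ℕ → Bool
    g v τ = f (remove v (insert v ρ) ∪ τ)
    c₀ = count (λ τ → f (ρ ∪ τ)) (combinations (suc r) S)
    𝟙f : List ℕ → ℕ
    𝟙f τ = indicator (f (ρ ∪ τ))
    ∑counts : ∑ℕ S (λ v → count (g v) (combinations (suc r) (F minus insert v ρ))) + suc r * c₀ ≡ suc D * c₀
    ∑counts = begin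
      ∑ℕ S (λ v → count (g v) (combinations (suc r) (F minus insert v ρ))) + suc r * c₀
        ≡⟨ cong₂ (λ s c → s + suc r * c)
             (∑-count-link (suc r) g (λ _ → 𝟙f)
               (All.map (λ v∉ρ τ → cong (λ σ → indicator (f (σ ∪ τ))) (remove-insert _ ρ v∉ρ)) S∌ρ))
             (count≡∑indicator _ (combinations (suc r) S)) ⟩
      ∑ℕ S (λ v → ∑ℕ (combinations (suc r) (remove v S)) 𝟙f) + suc r * ∑ℕ (combinations (suc r) S) 𝟙f
        ≡⟨ ∑ℕ-choose-remove (suc r) S 𝟙f sorted-S ⟩
      length S * ∑ℕ (combinations (suc r) S) 𝟙f
        ≡⟨ cong₂ _*_ |F∖ρ| (sym (count≡∑indicator (λ τ → f (ρ ∪ τ)) (combinations (suc r) S))) ⟩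
      suc D * c₀ ∎

  ∑-density-restrict-old : ∀ w → (w ∈ᵇ ρ) ≡ true →
    ∑ℚ S (λ v → density (suc r) (λ τ → f (remove w (insert v ρ) ∪ τ)) (F minus insert v ρ))
      ≡ fromℕ (suc D) ℚ.* density (suc (suc r)) (λ τ → f (remove w ρ ∪ τ)) S
  ∑-density-restrict-old w w∈ρ =
    ∑-density-link (suc r) (suc (suc r)) g (λ τ → f (remove w ρ ∪ τ)) r<D (s≤s r<D)
      (*-cross-scaled (suc (suc r)) c₀ (suc D) (binomial (suc r) D) (binomial (suc (suc r)) (suc D))
        ∑counts (binomial-absorption (suc r)))
    where
    open ≡-Reasoning
    g : ℕ → List ℕ → Bool
    g v τ = f (remove w (insert v ρ) ∪ τ)
    c₀ = count (λ τ → f (remove w ρ ∪ τ)) (combinations (suc (suc r)) S)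
    𝟙f : List ℕ → ℕ
    𝟙f τ = indicator (f (remove w ρ ∪ τ))
    v≢w : ∀ {v} → (v ∈ᵇ ρ) ≡ false → (v ≡ᵇ w) ≡ false
    v≢w {v} v∉ρ = ≢⇒≡ᵇ≡false {v} {w} λ { refl → contradiction (trans (sym w∈ρ) v∉ρ) λ () }
    ∑counts : ∑ℕ S (λ v → count (g v) (combinations (suc r) (F minus insert v ρ))) ≡ suc (suc r) * c₀
    ∑counts = begin
      ∑ℕ S (λ v → count (g v) (combinations (suc r) (F minus insert v ρ)))
        ≡⟨ ∑-count-link (suc r) g (λ v → 𝟙f ∘ insert v)
             (All.map (λ {v} v∉ρ τ → cong (indicator ∘ f) (remove-insert-∪-move v w ρ τ (v≢w {v} v∉ρ))) S∌ρ) ⟩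
      ∑ℕ S (λ v → ∑ℕ (combinations (suc r) (remove v S)) (𝟙f ∘ insert v))
        ≡⟨ ∑ℕ-choose-insert (suc r) S 𝟙f sorted-S ⟩
      suc (suc r) * ∑ℕ (combinations (suc (suc r)) S) 𝟙f
        ≡⟨ cong (suc (suc r) *_) (count≡∑indicator (λ τ → f (remove w ρ ∪ τ)) (combinations (suc (suc r)) S)) ⟨
      suc (suc r) * c₀ ∎

interval : ℕ → ℕ → List ℕ
interval a zero    = []
interval a (suc n) = a ∷ interval (suc a) n

interval-lower-bound : ∀ a n → All (a ≤_) (interval a n)
interval-lower-bound a zero    = []
interval-lower-bound a (suc n) = ℕ.≤-refl ∷ All.map (ℕ.≤-trans (ℕ.n≤1+n a)) (interval-lower-bound (suc a) n)

interval-sorted : ∀ a n → AllPairs _<_ (interval a n)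
interval-sorted a zero    = []
interval-sorted a (suc n) = interval-lower-bound (suc a) n ∷ interval-sorted (suc a) n

∈ᵇ-interval : ∀ a n x → a ≤ x → x < a + n → (x ∈ᵇ interval a n) ≡ true
∈ᵇ-interval a zero    x a≤x x<a+0 =
  contradiction (ℕ.<-≤-trans x<a+0 (ℕ.≤-trans (ℕ.≤-reflexive (ℕ.+-identityʳ a)) a≤x)) (<-irrefl refl)
∈ᵇ-interval a (suc n) x a≤x x<a+n with x ≡ᵇ a | ≡ᵇ-reflects-≡ x a
... | true  | _        = refl
... | false | ofⁿ x≢a = ∈ᵇ-interval (suc a) n x (ℕ.≤∧≢⇒< a≤x (x≢a ∘ sym)) (subst (x <_) (ℕ.+-suc a n) x<a+n)

∈ᵇ⇒≤∑ : ∀ x F → (x ∈ᵇ F) ≡ true → x ≤ ∑ℕ F (λ y → y)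
∈ᵇ⇒≤∑ x (y ∷ ys) x∈ with x ≡ᵇ y | ≡ᵇ-reflects-≡ x y
... | true  | ofʸ refl = ℕ.m≤m+n x _
... | false | _        = ℕ.≤-trans (∈ᵇ⇒≤∑ x ys x∈) (ℕ.m≤n+m _ y)

-- The new vertex v ranges over an explicit interval containing every vertex of X, so that the sum
-- over v can be exchanged with the sum over the facets through ρ.
module FacetsThrough (X : Complex) (ρ : List ℕ) where

  vertexBound : ℕ
  vertexBound = ∑ℕ (facets X) (λ F → ∑ℕ F (λ y → y))

  facet-vertices-bounded : All (λ F → ∀ x → (x ∈ᵇ F) ≡ true → x ≤ vertexBound) (facets X)
  facet-vertices-bounded = go (facets X)
    where
    go : ∀ Fs → All (λ F → ∀ x → (x ∈ᵇ F) ≡ true → x ≤ ∑ℕ Fs (λ F → ∑ℕ F (λ y → y))) Fs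
    go []       = []
    go (F ∷ Fs) = (λ x x∈F → ℕ.≤-trans (∈ᵇ⇒≤∑ x F x∈F) (ℕ.m≤m+n _ _))
                ∷ All.map (λ bound x x∈ → ℕ.≤-trans (bound x x∈) (ℕ.m≤n+m _ _)) (go Fs)

  vertices : List ℕ
  vertices = interval 0 (suc vertexBound)

  vertices∖ρ : List ℕ
  vertices∖ρ = filterB (λ v → not (v ∈ᵇ ρ)) vertices

  vertices∖ρ∩F : ∀ F → AllPairs _<_ F → (∀ x → (x ∈ᵇ F) ≡ true → x ≤ vertexBound) →
                 filterB (_∈ᵇ F) vertices∖ρ ≡ F minus ρ
  vertices∖ρ∩F F sorted-F bounded =
    sorted-extensional
      (sorted-filterB (_∈ᵇ F) (sorted-filterB (λ v → not (v ∈ᵇ ρ)) (interval-sorted 0 (suc vertexBound))))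
      (sorted-filterB _ sorted-F) same-members
    where
    same-members : ∀ x → (x ∈ᵇ filterB (_∈ᵇ F) vertices∖ρ) ≡ (x ∈ᵇ (F minus ρ))
    same-members x rewrite ∈ᵇ-filterB (_∈ᵇ F) x vertices∖ρ | ∈ᵇ-filterB (λ v → not (v ∈ᵇ ρ)) x vertices
                         | ∈ᵇ-filterB (λ v → not (v ∈ᵇ ρ)) x F with x ∈ᵇ F in x∈F
    ... | false = sym (∧-zeroʳ _)
    ... | true rewrite ∈ᵇ-interval 0 (suc vertexBound) x z≤n (s≤s (bounded x x∈F)) = refl

  ∑-facet-through-vertex : ∀ (h : ℕ → List ℕ → ℚ) F → AllPairs _<_ F →
    (∀ x → (x ∈ᵇ F) ≡ true → x ≤ vertexBound) →
    ∑ℚ vertices∖ρ (λ v → if insert v ρ ⊆ᵇ F then h v F else 0ℚ)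
      ≡ (if ρ ⊆ᵇ F then ∑ℚ (F minus ρ) (λ v → h v F) else 0ℚ)
  ∑-facet-through-vertex h F sorted-F bounded with ρ ⊆ᵇ F in ρ⊆F
  ... | false = trans (∑ℚ-cong′ vertices∖ρ (λ v → cong (λ b → if b then h v F else 0ℚ)
                        (trans (allB-insert (_∈ᵇ F) v ρ) (trans (cong ((v ∈ᵇ F) ∧_) ρ⊆F) (∧-zeroʳ _)))))
                      (∑ℚ-zero vertices∖ρ)
  ... | true  = trans (∑ℚ-cong′ vertices∖ρ (λ v → cong (λ b → if b then h v F else 0ℚ)
                        (trans (allB-insert (_∈ᵇ F) v ρ) (trans (cong ((v ∈ᵇ F) ∧_) ρ⊆F) (∧-identityʳ _)))))
                  (trans (sym (∑ℚ-filterB (_∈ᵇ F) vertices∖ρ (λ v → h v F)))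
                         (cong (λ L → ∑ℚ L (λ v → h v F)) (vertices∖ρ∩F F sorted-F bounded)))

  ∑-facets-through-vertex : ∀ (h : ℕ → List ℕ → ℚ) →
    ∑ℚ vertices∖ρ (λ v → ∑ℚ (containing X (insert v ρ)) (h v))
      ≡ ∑ℚ (containing X ρ) (λ F → ∑ℚ (F minus ρ) (λ v → h v F))
  ∑-facets-through-vertex h = begin
    ∑ℚ vertices∖ρ (λ v → ∑ℚ (containing X (insert v ρ)) (h v))
      ≡⟨ ∑ℚ-cong′ vertices∖ρ (λ v → ∑ℚ-filterB (insert v ρ ⊆ᵇ_) (facets X) (h v)) ⟩
    ∑ℚ vertices∖ρ (λ v → ∑ℚ (facets X) (λ F → if insert v ρ ⊆ᵇ F then h v F else 0ℚ))
      ≡⟨ ∑ℚ-swap vertices∖ρ (facets X) (λ v F → if insert v ρ ⊆ᵇ F then h v F else 0ℚ) ⟩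
    ∑ℚ (facets X) (λ F → ∑ℚ vertices∖ρ (λ v → if insert v ρ ⊆ᵇ F then h v F else 0ℚ))
      ≡⟨ ∑ℚ-cong (facets X) (All.zipWith (λ (sorted-F , bounded) → ∑-facet-through-vertex h _ sorted-F bounded)
                               (All.map (Linked⇒AllPairs <-trans) (sorted X) , facet-vertices-bounded)) ⟩
    ∑ℚ (facets X) (λ F → if ρ ⊆ᵇ F then ∑ℚ (F minus ρ) (λ v → h v F) else 0ℚ)
      ≡⟨ ∑ℚ-filterB (ρ ⊆ᵇ_) (facets X) (λ F → ∑ℚ (F minus ρ) (λ v → h v F)) ⟨
    ∑ℚ (containing X ρ) (λ F → ∑ℚ (F minus ρ) (λ v → h v F)) ∎
    where open ≡-Reasoning

-- The double balance inequality at a face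

avg-map : ∀ {A : Set} (φ : A → ℚ) xs → avg (map φ xs) ≡ ∑ℚ xs φ ℚ.* frac 1 (length xs)
avg-map φ xs = cong₂ ℚ._*_ (sumℚ-map φ xs) (cong (frac 1) (List.length-map φ xs))

-- DoubleBalanced X k f 1ℚ ℓ unfolds to ∀ σ → Face X ℓ σ → BalancedAt X f (k ∸ ℓ) σ.
BalancedAt : Complex → Cochain → ℕ → List ℕ → Set
BalancedAt X f r σ =
  linkNorm X σ r (λ τ → f (σ ∪ τ)) ℚ.≤ 1ℚ ℚ.* avg (map (λ u → linkNorm X σ (suc r) (λ τ → f (remove u σ ∪ τ))) σ)

SummedBalancedAt : Complex → Cochain → ℕ → List ℕ → Set
SummedBalancedAt X f r σ =
  fromℕ (length σ) ℚ.* ∑ℚ (containing X σ) (λ F → density r (λ τ → f (σ ∪ τ)) (F minus σ))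
    ℚ.≤ ∑ℚ σ (λ u → ∑ℚ (containing X σ) (λ F → density (suc r) (λ τ → f (remove u σ ∪ τ)) (F minus σ)))

module _ (X : Complex) (f : Cochain) (r : ℕ) (σ : List ℕ) where

  private
    L = containing X σ
    loc : List ℕ → ℚ
    loc F = density r (λ τ → f (σ ∪ τ)) (F minus σ)
    res : ℕ → List ℕ → ℚ
    res u F = density (suc r) (λ τ → f (remove u σ ∪ τ)) (F minus σ)

  BalancedAt≡ : BalancedAt X f r σ ≡
    (∑ℚ L loc ℚ.* frac 1 (length L)
       ℚ.≤ 1ℚ ℚ.* (∑ℚ σ (λ u → ∑ℚ L (res u)) ℚ.* frac 1 (length L) ℚ.* frac 1 (length σ)))
  BalancedAt≡ = cong₂ ℚ._≤_ (avg-map loc L) (cong (1ℚ ℚ.*_) (begin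
    avg (map (λ u → linkNorm X σ (suc r) (λ τ → f (remove u σ ∪ τ))) σ)
      ≡⟨ avg-map _ σ ⟩
    ∑ℚ σ (λ u → avg (map (res u) L)) ℚ.* frac 1 (length σ)
      ≡⟨ cong (ℚ._* frac 1 (length σ)) (∑ℚ-cong′ σ (λ u → avg-map (res u) L)) ⟩
    ∑ℚ σ (λ u → ∑ℚ L (res u) ℚ.* frac 1 (length L)) ℚ.* frac 1 (length σ)
      ≡⟨ cong (ℚ._* frac 1 (length σ)) (∑ℚ-*ʳ σ (frac 1 (length L)) (λ u → ∑ℚ L (res u))) ⟩
    ∑ℚ σ (λ u → ∑ℚ L (res u)) ℚ.* frac 1 (length L) ℚ.* frac 1 (length σ) ∎))
    where open ≡-Reasoning

  balanced⇒summed : 0 < length σ → (0 < length L → BalancedAt X f r σ) → SummedBalancedAt X f r σ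
  balanced⇒summed 0<|σ| balanced with L | BalancedAt≡
  ... | []     | _  = ℚ.≤-reflexive (trans (ℚ.*-zeroʳ (fromℕ (length σ))) (sym (∑ℚ-zero σ)))
  ... | F ∷ Fs | eq =
    ≤-avg⇒≤-sum (∑ℚ (F ∷ Fs) loc) (∑ℚ σ (λ u → ∑ℚ (F ∷ Fs) (res u))) (length (F ∷ Fs)) (length σ)
      (s≤s z≤n) 0<|σ| (subst id eq (balanced (s≤s z≤n)))

  summed⇒balanced : 0 < length σ → SummedBalancedAt X f r σ → BalancedAt X f r σ
  summed⇒balanced 0<|σ| summed =
    subst id (sym BalancedAt≡)
      (≤-sum⇒≤-avg (∑ℚ L loc) (∑ℚ σ (λ u → ∑ℚ L (res u))) (length L) (length σ) 0<|σ| summed)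

module ExtensionSums (X : Complex) (f : Cochain) (m r D : ℕ) (ρ : List ℕ) (linked-ρ : Linked _<_ ρ)
                     (|ρ| : length ρ ≡ suc m) (dims : suc D + suc m ≡ suc (dim X)) (r<D : suc r ≤ D) where

  open FacetsThrough X ρ using (vertices; vertices∖ρ; ∑-facets-through-vertex)
  open FacetDensities using (∑-density-localize; ∑-density-restrict-new; ∑-density-restrict-old)

  sorted-ρ : AllPairs _<_ ρ
  sorted-ρ = Linked⇒AllPairs <-trans linked-ρ

  d : ℚ
  d = fromℕ (suc D)

  Lρ : List (List ℕ)
  Lρ = containing X ρ

  ΣA ΣB : ℚ
  ΣA = ∑ℚ Lρ (λ F → density (suc r) (λ τ → f (ρ ∪ τ)) (F minus ρ))
  ΣB = ∑ℚ ρ (λ w → ∑ℚ Lρ (λ F → density (suc (suc r)) (λ τ → f (remove w ρ ∪ τ)) (F minus ρ)))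

  cont : ℕ → List (List ℕ)
  cont v = containing X (insert v ρ)

  φ : ℕ → List ℕ → ℚ
  φ v F = density r (λ τ → f (insert v ρ ∪ τ)) (F minus insert v ρ)

  ψ : ℕ → ℕ → List ℕ → ℚ
  ψ v u F = density (suc r) (λ τ → f (remove u (insert v ρ) ∪ τ)) (F minus insert v ρ)

  facet-shape : All (λ F → AllPairs _<_ F × length (F minus ρ) ≡ suc D) Lρ
  facet-shape = All.zipWith shape
    (All-filterB (ρ ⊆ᵇ_) (All.zip (All.map (Linked⇒AllPairs <-trans) (sorted X) , facetSize X)) ,
     All-filterB-accepted (ρ ⊆ᵇ_) (facets X))
    where
    shape : ∀ {F} → (AllPairs _<_ F × length F ≡ suc (dim X)) × (ρ ⊆ᵇ F) ≡ true →
            AllPairs _<_ F × length (F minus ρ) ≡ suc D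
    shape {F} ((sorted-F , |F|) , ρ⊆F) = sorted-F , ℕ.+-cancelʳ-≡ (suc m) _ _ (begin
      length (F minus ρ) + suc m     ≡⟨ cong (length (F minus ρ) +_) |ρ| ⟨
      length (F minus ρ) + length ρ  ≡⟨ length-minus sorted-ρ sorted-F ρ⊆F ⟩
      length F                       ≡⟨ trans |F| (sym dims) ⟩
      suc D + suc m                  ∎)
      where open ≡-Reasoning

  ∑-facets-scaled : ∀ (h k : List ℕ → ℚ) →
    (∀ {F} → AllPairs _<_ F → length (F minus ρ) ≡ suc D → h F ≡ d ℚ.* k F) → ∑ℚ Lρ h ≡ d ℚ.* ∑ℚ Lρ k
  ∑-facets-scaled h k eq =
    trans (∑ℚ-cong Lρ (All.map (λ (sorted-F , |F∖ρ|) → eq sorted-F |F∖ρ|) facet-shape)) (∑ℚ-*ˡ Lρ d k)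

  ∑-localized : ∑ℚ vertices∖ρ (λ v → ∑ℚ (cont v) (φ v)) ≡ d ℚ.* ΣA
  ∑-localized = trans (∑-facets-through-vertex φ)
    (∑-facets-scaled _ _ (λ {F} sorted-F |F∖ρ| → ∑-density-localize f ρ F r D sorted-F |F∖ρ| r<D))

  ∑-restricted-new : ∑ℚ vertices∖ρ (λ v → ∑ℚ (cont v) (ψ v v)) ≡ d ℚ.* ΣA
  ∑-restricted-new = trans (∑-facets-through-vertex (λ v → ψ v v))
    (∑-facets-scaled _ _ (λ {F} sorted-F |F∖ρ| → ∑-density-restrict-new f ρ F r D sorted-F |F∖ρ| r<D))

  ∑-restricted-old : ∑ℚ vertices∖ρ (λ v → ∑ℚ ρ (λ w → ∑ℚ (cont v) (ψ v w))) ≡ d ℚ.* ΣB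
  ∑-restricted-old = begin
    ∑ℚ vertices∖ρ (λ v → ∑ℚ ρ (λ w → ∑ℚ (cont v) (ψ v w)))  ≡⟨ ∑ℚ-swap vertices∖ρ ρ _ ⟩
    ∑ℚ ρ (λ w → ∑ℚ vertices∖ρ (λ v → ∑ℚ (cont v) (ψ v w)))  ≡⟨ ∑ℚ-cong ρ (All.map at-vertex (∈ᵇ-self ρ)) ⟩
    ∑ℚ ρ (λ w → d ℚ.* ∑ℚ Lρ (B w))                          ≡⟨ ∑ℚ-*ˡ ρ d _ ⟩
    d ℚ.* ΣB                                                ∎
    where
    open ≡-Reasoning
    B : ℕ → List ℕ → ℚ
    B w F = density (suc (suc r)) (λ τ → f (remove w ρ ∪ τ)) (F minus ρ)
    at-vertex : ∀ {w} → (w ∈ᵇ ρ) ≡ true → ∑ℚ vertices∖ρ (λ v → ∑ℚ (cont v) (ψ v w)) ≡ d ℚ.* ∑ℚ Lρ (B w)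
    at-vertex {w} w∈ρ = trans (∑-facets-through-vertex (λ v → ψ v w))
      (∑-facets-scaled _ _ (λ {F} sorted-F |F∖ρ| → ∑-density-restrict-old f ρ F r D sorted-F |F∖ρ| r<D w w∈ρ))

  ∑-restricted : ∑ℚ vertices∖ρ (λ v → ∑ℚ (insert v ρ) (λ u → ∑ℚ (cont v) (ψ v u))) ≡ d ℚ.* ΣA ℚ.+ d ℚ.* ΣB
  ∑-restricted = begin
    ∑ℚ vertices∖ρ (λ v → ∑ℚ (insert v ρ) (λ u → ∑ℚ (cont v) (ψ v u)))
      ≡⟨ ∑ℚ-cong′ vertices∖ρ (λ v → ∑ℚ-insert v ρ (λ u → ∑ℚ (cont v) (ψ v u))) ⟩
    ∑ℚ vertices∖ρ (λ v → ∑ℚ (cont v) (ψ v v) ℚ.+ ∑ℚ ρ (λ w → ∑ℚ (cont v) (ψ v w)))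
      ≡⟨ ∑ℚ-+ vertices∖ρ _ _ ⟩
    ∑ℚ vertices∖ρ (λ v → ∑ℚ (cont v) (ψ v v)) ℚ.+ ∑ℚ vertices∖ρ (λ v → ∑ℚ ρ (λ w → ∑ℚ (cont v) (ψ v w)))
      ≡⟨ cong₂ ℚ._+_ ∑-restricted-new ∑-restricted-old ⟩
    d ℚ.* ΣA ℚ.+ d ℚ.* ΣB ∎
    where open ≡-Reasoning

  summed-at-extension : (∀ σ → Face X (suc m) σ → BalancedAt X f r σ) → ∀ {v} → (v ∈ᵇ ρ) ≡ false →
    fromℕ (suc (suc m)) ℚ.* ∑ℚ (cont v) (φ v) ℚ.≤ ∑ℚ (insert v ρ) (λ u → ∑ℚ (cont v) (ψ v u))
  summed-at-extension balanced {v} v∉ρ =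
    subst (λ n → fromℕ n ℚ.* ∑ℚ (cont v) (φ v) ℚ.≤ ∑ℚ (insert v ρ) (λ u → ∑ℚ (cont v) (ψ v u))) |ρ+v|
      (balanced⇒summed X f r (insert v ρ) (subst (0 <_) (sym |ρ+v|) (s≤s z≤n))
        (λ nonempty → balanced (insert v ρ)
          (AllPairs⇒Linked (sorted-insert v sorted-ρ v∉ρ) , |ρ+v| , filterB-nonempty⇒Any _ (facets X) nonempty)))
    where
    |ρ+v| : length (insert v ρ) ≡ suc (suc m)
    |ρ+v| = trans (length-insert v ρ) (cong suc |ρ|)

  summed-over-extensions : (∀ σ → Face X (suc m) σ → BalancedAt X f r σ) →
    fromℕ (suc (suc m)) ℚ.* (d ℚ.* ΣA) ℚ.≤ d ℚ.* ΣA ℚ.+ d ℚ.* ΣB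
  summed-over-extensions balanced = subst₂ ℚ._≤_
    (trans (∑ℚ-*ˡ vertices∖ρ (fromℕ (suc (suc m))) (λ v → ∑ℚ (cont v) (φ v)))
           (cong (fromℕ (suc (suc m)) ℚ.*_) ∑-localized))
    ∑-restricted
    (∑ℚ-mono vertices∖ρ (All.map (summed-at-extension balanced ∘ not-injective) (All-filterB-accepted _ vertices)))

balanced-step : ∀ X f m r D ρ → Face X m ρ → suc D + suc m ≡ suc (dim X) → suc r ≤ D →
  (∀ σ → Face X (suc m) σ → BalancedAt X f r σ) → BalancedAt X f (suc r) ρ
balanced-step X f m r D ρ (linked-ρ , |ρ| , _) dims r<D balanced =
  summed⇒balanced X f (suc r) ρ (subst (0 <_) (sym |ρ|) (s≤s z≤n))
    (subst (λ n → fromℕ n ℚ.* ΣA ℚ.≤ ΣB) (sym |ρ|) (cancel-common-summand m D ΣA ΣB (summed-over-extensions balanced)))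
  where open ExtensionSums X f m r D ρ linked-ρ |ρ| dims r<D

double-balanced-step : ∀ X k f m → suc m < k → k < dim X →
  DoubleBalanced X k f 1ℚ (suc m) → DoubleBalanced X k f 1ℚ m
double-balanced-step X k f m m+1<k k<d balanced ρ ρ-face =
  -- k ∸ m ≡ suc (k ∸ suc m) since m < k
  subst (λ r → BalancedAt X f r ρ) (sym (ℕ.+-∸-assoc 1 (ℕ.<⇒≤ m+1<k)))
    (balanced-step X f m (k ∸ suc m) (dim X ∸ suc m) ρ ρ-face
      (cong suc (ℕ.m∸n+n≡m (ℕ.<⇒≤ (<-trans m+1<k k<d))))
      (ℕ.∸-monoˡ-< k<d (ℕ.<⇒≤ m+1<k))
      balanced)

corollary3p3 : (X : Complex) (k : ℕ) (f : Cochain) (ℓ : ℕ) →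
    k < dim X → ℓ < k →
    DoubleBalanced X k f 1ℚ ℓ →
    (ℓ′ : ℕ) → ℓ′ ≤ ℓ → DoubleBalanced X k f 1ℚ ℓ′
corollary3p3 X k f ℓ k<d ℓ<k balanced ℓ′ ℓ′≤ℓ with ℕ.m≤n⇒m<n∨m≡n ℓ′≤ℓ
... | inj₂ refl = balanced
corollary3p3 X k f (suc m) k<d m+1<k balanced ℓ′ _ | inj₁ (s≤s ℓ′≤m) =
  corollary3p3 X k f m k<d (<-trans (ℕ.n<1+n m) m+1<k) (double-balanced-step X k f m m+1<k k<d balanced) ℓ′ ℓ′≤m
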